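{- Let $\mathcal M_1=(W_1,\preccurlyeq_1,S_1,V_1)$ and $\mathcal M_2=(W_2,\preccurlyeq_2,S_2,V_2)$ be models and let $\mathcal Z_n\subseteq\cdots\subseteq\mathcal Z_0$ be a bounded $\bigcirc$-bisimulation between them. Then for all $i\le n$ and all $(w_1,w_2)\in W_1\times W_2$, if $w_1\mathcal Z_i w_2$, then for every $\varphi\in\mathcal L_{\bigcirc}$ with $|\varphi|\le i$, $\mathcal M_1,w_1\models\varphi$ iff $\mathcal M_2,w_2\models\varphi$.
   Context: A model is $(W,\preccurlyeq,S,V)$ with $\preccurlyeq$ a partial order on $W\ne\emptyset$, $S:W\to W$ satisfying $w\preccurlyeq v\Rightarrow S(w)\preccurlyeq S(v)$, and $V$ assigning each world a set of propositional variables with $w\preccurlyeq v\Rightarrow V(w)\subseteq V(v)$. $\mathcal L_\bigcirc$ is the set of formulas built from propositional variables and $\bot$ using $\wedge,\vee,\to,\bigcirc$ (with $\neg\varphi:=\varphi\to\bot$ allowed). Satisfaction: $w\models p$ iff $p\in V(w)$; $w\not\models\bot$; $\wedge,\vee$ classical; $w\models\varphi\to\psi$ iff for all $v\succcurlyeq w$, $v\models\varphi$ implies $v\models\psi$; $w\models\bigcirc\varphi$ iff $S(w)\models\varphi$. Length: $|p|=|\bot|=0$; $|\varphi\odot\psi|=1+|\varphi|+|\psi|$ for binary $\odot$; $|\odot\psi|=1+|\psi|$ for unary $\odot\in\{\neg,\bigcirc,\Box,\Diamond\}$. For $n>0$, a bounded $\bigcirc$-bisimulation between $\mathcal M_1,\mathcal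 M_2$ is a sequence of relations $\mathcal Z_n\subseteq\cdots\subseteq\mathcal Z_0\subseteq W_1\times W_2$ such that for all $(w_1,w_2)$ and all $0\le i<n$: (Atoms) if $w_1\mathcal Z_iw_2$ then $w_1,w_2$ satisfy the same variables; (Forth $\to$) if $w_1\mathcal Z_{i+1}w_2$ then for every $v_1\succcurlyeq w_1$ there is $v_2\succcurlyeq w_2$ with $v_1\mathcal Z_iv_2$; (Back $\to$) if $w_1\mathcal Z_{i+1}w_2$ then for every $v_2\succcurlyeq w_2$ there is $v_1\succcurlyeq w_1$ with $v_1\mathcal Z_iv_2$; (Forth $\bigcirc$) if $w_1\mathcal Z_{i+1}w_2$ then $S_1(w_1)\mathcal Z_iS_2(w_2)$. -}

module Defs where

open import Data.Nat using (ℕ; zero; suc; _+_; _≤_; _<_)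
open import Data.Product using (_×_; Σ-syntax; ∃-syntax)
open import Data.Sum using (_⊎_)
open import Data.Empty using (⊥)
open import Relation.Binary.PropositionalEquality using (_≡_)
open import Function.Bundles using (_⇔_)

Var : Set
Var = ℕ

record Model : Set₁ where
  field
    W        : Set
    inhabited : W
    _≼_      : W → W → Set
    ≼-refl   : ∀ {w} → w ≼ w
    ≼-trans  : ∀ {u v w} → u ≼ v → v ≼ w → u ≼ w
    ≼-antisym : ∀ {u v} → u ≼ v → v ≼ u → u ≡ v
    S        : W → W
    S-mono   : ∀ {w v} → w ≼ v → S w ≼ S v
    V        : W → Var → Set
    V-mono   : ∀ {w v} → w ≼ v → ∀ p → V w p → V v p

data Form : Set where
  var  : Var → Form
  ⊥'   : Form
  _∧'_ : Form → Form → Form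
  _∨'_ : Form → Form → Form
  _⇒_  : Form → Form → Form
  ○    : Form → Form

¬' : Form → Form
¬' φ = φ ⇒ ⊥'

∣_∣ : Form → ℕ
∣ var p ∣   = 0
∣ ⊥' ∣      = 0
∣ φ ∧' ψ ∣  = suc (∣ φ ∣ + ∣ ψ ∣)
∣ φ ∨' ψ ∣  = suc (∣ φ ∣ + ∣ ψ ∣)
∣ φ ⇒ ψ ∣   = suc (∣ φ ∣ + ∣ ψ ∣)
∣ ○ φ ∣     = suc ∣ φ ∣

_,_⊨_ : (M : Model) → Model.W M → Form → Set
M , w ⊨ var p   = Model.V M w p
M , w ⊨ ⊥'      = ⊥
M , w ⊨ (φ ∧' ψ) = (M , w ⊨ φ) × (M , w ⊨ ψ)
M , w ⊨ (φ ∨' ψ) = (M , w ⊨ φ) ⊎ (M , w ⊨ ψ)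
M , w ⊨ (φ ⇒ ψ) = ∀ v → Model._≼_ M w v → M , v ⊨ φ → M , v ⊨ ψ
M , w ⊨ ○ φ     = M , Model.S M w ⊨ φ

record BoundedBisim (n : ℕ) (M₁ M₂ : Model) : Set₁ where
  open Model M₁ renaming (W to W₁; _≼_ to _≼₁_; S to S₁; V to V₁)
  open Model M₂ renaming (W to W₂; _≼_ to _≼₂_; S to S₂; V to V₂)
  field
    Z      : ℕ → W₁ → W₂ → Set
    nested : ∀ i → i < n → ∀ {w₁ w₂} → Z (suc i) w₁ w₂ → Z i w₁ w₂
    atoms  : ∀ i → i < n → ∀ {w₁ w₂} → Z i w₁ w₂ → ∀ p → V₁ w₁ p ⇔ V₂ w₂ p
    forth→ : ∀ i → i < n → ∀ {w₁ w₂} → Z (suc i) w₁ w₂ →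
             ∀ v₁ → w₁ ≼₁ v₁ → ∃[ v₂ ] (w₂ ≼₂ v₂ × Z i v₁ v₂)
    back→  : ∀ i → i < n → ∀ {w₁ w₂} → Z (suc i) w₁ w₂ →
             ∀ v₂ → w₂ ≼₂ v₂ → ∃[ v₁ ] (w₁ ≼₁ v₁ × Z i v₁ v₂)
    forth○ : ∀ i → i < n → ∀ {w₁ w₂} → Z (suc i) w₁ w₂ → Z i (S₁ w₁) (S₂ w₂)

module Submission where

-- The proof is by induction on the formula φ, simultaneously for all levels
-- i ≤ n and all pairs w₁ Z i w₂.  Atoms agree at every level i ≤ n (at the
-- top level n we first descend along Z n ⊆ Z (n-1), which needs 0 < n);
-- ⊥ is trivial; ∧ and ∨ follow from the induction hypotheses at the same
-- level, since their operands are shorter.  The two modal-like connectives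
-- consume one level: a formula φ ⇒ ψ or ○ φ of length ≤ i forces i = j+1
-- with ∣φ∣,∣ψ∣ ≤ j, and then
--   * ○ φ is handled by the (Forth ○) clause, landing in Z j;
--   * φ ⇒ ψ is handled by a general transfer lemma: for any relation R
--     with the forth and back property along ≼ from (w₁,w₂), implications
--     between R-invariant formulas agree at w₁ and w₂.  The (Forth →) and
--     (Back →) clauses provide exactly this property for R = Z j.

open import Defs
open import Data.Nat using (ℕ; zero; suc; _≤_; _<_; s≤s)
open import Data.Nat.Properties using (<⇒≤; m+n≤o⇒m≤o; m+n≤o⇒n≤o)
open import Data.Product using (_×_; _,_; ∃-syntax)
open import Data.Product.Function.NonDependent.Propositional using (_×-⇔_)
open import Data.Sum.Function.Propositional using (_⊎-⇔_)
open import Function.Bundles using (_⇔_; mk⇔; Equivalence)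
open import Function.Properties.Equivalence using () renaming (refl to ⇔-refl)

open Equivalence using (to; from)

⇒-transfer : (M₁ M₂ : Model) (R : Model.W M₁ → Model.W M₂ → Set)
  {w₁ : Model.W M₁} {w₂ : Model.W M₂} →
  (∀ v₁ → Model._≼_ M₁ w₁ v₁ → ∃[ v₂ ] (Model._≼_ M₂ w₂ v₂ × R v₁ v₂)) →
  (∀ v₂ → Model._≼_ M₂ w₂ v₂ → ∃[ v₁ ] (Model._≼_ M₁ w₁ v₁ × R v₁ v₂)) →
  ∀ φ ψ →
  (∀ {v₁ v₂} → R v₁ v₂ → (M₁ , v₁ ⊨ φ) ⇔ (M₂ , v₂ ⊨ φ)) →
  (∀ {v₁ v₂} → R v₁ v₂ → (M₁ , v₁ ⊨ ψ) ⇔ (M₂ , v₂ ⊨ ψ)) →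
  (M₁ , w₁ ⊨ (φ ⇒ ψ)) ⇔ (M₂ , w₂ ⊨ (φ ⇒ ψ))
⇒-transfer M₁ M₂ R {w₁} {w₂} forth back φ ψ φ-inv ψ-inv =
  mk⇔ left-to-right right-to-left
  where
  left-to-right : M₁ , w₁ ⊨ (φ ⇒ ψ) → M₂ , w₂ ⊨ (φ ⇒ ψ)
  left-to-right h v₂ w₂≼v₂ φ-at-v₂ =
    let (v₁ , w₁≼v₁ , r) = back v₂ w₂≼v₂
    in to (ψ-inv r) (h v₁ w₁≼v₁ (from (φ-inv r) φ-at-v₂))

  right-to-left : M₂ , w₂ ⊨ (φ ⇒ ψ) → M₁ , w₁ ⊨ (φ ⇒ ψ)
  right-to-left h v₁ w₁≼v₁ φ-at-v₁ =
    let (v₂ , w₂≼v₂ , r) = forth v₁ w₁≼v₁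
    in from (ψ-inv r) (h v₂ w₂≼v₂ (to (φ-inv r) φ-at-v₁))

module _ {n : ℕ} (0<n : 0 < n) {M₁ M₂ : Model} (B : BoundedBisim n M₁ M₂) where
  open BoundedBisim B

  -- Atom agreement holds at every level i ≤ n, not only below n: a pair in
  -- Z (j+1) with j < n is also in Z j, where the (Atoms) clause applies.
  atoms-≤ : ∀ i → i ≤ n → ∀ {w₁ w₂} → Z i w₁ w₂ →
            ∀ p → Model.V M₁ w₁ p ⇔ Model.V M₂ w₂ p
  atoms-≤ zero    _   z = atoms zero 0<n z
  atoms-≤ (suc j) j<n z = atoms j j<n (nested j j<n z)

  -- Pairs in Z i agree on every formula of length ≤ i, by induction on φ.
  -- For ⇒ and ○ the length bound rules out i = 0, so only i = j+1 occurs.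
  invariance : ∀ φ i → i ≤ n → ∣ φ ∣ ≤ i → ∀ {w₁ w₂} → Z i w₁ w₂ →
               (M₁ , w₁ ⊨ φ) ⇔ (M₂ , w₂ ⊨ φ)
  invariance (var p)  i i≤n _ z = atoms-≤ i i≤n z p
  invariance ⊥'       i i≤n _ z = ⇔-refl
  invariance (φ ∧' ψ) i i≤n ∣φ∧ψ∣<i z =
    invariance φ i i≤n (m+n≤o⇒m≤o ∣ φ ∣ (<⇒≤ ∣φ∧ψ∣<i)) z
      ×-⇔ invariance ψ i i≤n (m+n≤o⇒n≤o ∣ φ ∣ (<⇒≤ ∣φ∧ψ∣<i)) z
  invariance (φ ∨' ψ) i i≤n ∣φ∨ψ∣<i z =
    invariance φ i i≤n (m+n≤o⇒m≤o ∣ φ ∣ (<⇒≤ ∣φ∨ψ∣<i)) z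
      ⊎-⇔ invariance ψ i i≤n (m+n≤o⇒n≤o ∣ φ ∣ (<⇒≤ ∣φ∨ψ∣<i)) z
  invariance (φ ⇒ ψ) (suc j) j<n (s≤s ∣φ∣+∣ψ∣≤j) z =
    ⇒-transfer M₁ M₂ (Z j) (forth→ j j<n z) (back→ j j<n z) φ ψ
      (invariance φ j (<⇒≤ j<n) (m+n≤o⇒m≤o ∣ φ ∣ ∣φ∣+∣ψ∣≤j))
      (invariance ψ j (<⇒≤ j<n) (m+n≤o⇒n≤o ∣ φ ∣ ∣φ∣+∣ψ∣≤j))
  invariance (○ φ) (suc j) j<n (s≤s ∣φ∣≤j) z =
    invariance φ j (<⇒≤ j<n) ∣φ∣≤j (forth○ j j<n z)

mainTheorem11 : (n : ℕ) → 0 < n → (M₁ M₂ : Model) → (B : BoundedBisim n M₁ M₂) →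
    ∀ i → i ≤ n → (w₁ : Model.W M₁) → (w₂ : Model.W M₂) → BoundedBisim.Z B i w₁ w₂ →
    ∀ (φ : Form) → ∣ φ ∣ ≤ i → (M₁ , w₁ ⊨ φ) ⇔ (M₂ , w₂ ⊨ φ)
mainTheorem11 n 0<n M₁ M₂ B i i≤n w₁ w₂ z φ ∣φ∣≤i = invariance 0<n B φ i i≤n ∣φ∣≤i z
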